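{- Let $X$ be a finite alphabet with $|X|=N$, symbols of types GEN, PROP, KILL with counts $g,t,k$, $g+k\ge1$; let $x_1,x_2,\dots$ be i.i.d. uniform on $X$, $\sigma_0=0$, $\sigma_j=T_{x_j}(\sigma_{j-1})$, $\mu=t/N$, $(\pi_0,\pi_1)=(k/(g+k),g/(g+k))$, $\nu=\sum_{j=1}^L\sigma_j$. Then: (a) $\mathrm P(\sigma_j=1)=\pi_1(1-\mu^j)$ for $j\ge1$; (b) $\mathrm E[\nu]=\pi_1\bigl[L-\mu(1-\mu^L)/(1-\mu)\bigr]$; (c) for $1\le j<m\le L$, $\mathrm{Cov}(\sigma_j,\sigma_m)=\pi_1(1-\mu^j)\mu^{m-j}(\pi_0+\pi_1\mu^j)$.
   Context: GEN symbols act on the state space $\{0,1\}$ as the constant map $1$, PROP as the identity, KILL as the constant map $0$; $T_x$ is the action of $x$. -}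

module Defs where

open import Data.Bool using (Bool; true; false)
open import Data.Nat as ℕ using (ℕ; zero; suc)
open import Data.Fin using (Fin)
open import Data.List using (List; []; _∷_; map; concatMap; foldl; foldr; take)
open import Data.Vec.Functional using (Vector)
open import Data.Integer using (+_)
open import Data.Rational using (ℚ; 0ℚ; 1ℚ; _+_; _*_; _÷_; _/_; ≢-nonZero)
open import Data.Rational.Properties using (_≟_)
open import Relation.Nullary using (yes; no)

data Kind : Set where
  GEN PROP KILL : Kind

-- Action T of a symbol type on the state space {0,1} (false = 0, true = 1):
-- GEN = constant 1, PROP = identity, KILL = constant 0.
T : Kind → Bool → Bool
T GEN  _ = true
T PROP s = s
T KILL _ = false

-- An alphabet X of size N is Fin N, with a type assignment τ : Fin N → Kind.
-- Number of symbols of a given kind.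
isKind : Kind → Kind → ℕ
isKind GEN  GEN  = 1
isKind PROP PROP = 1
isKind KILL KILL = 1
isKind _    _    = 0

count : (N : ℕ) → (Fin N → Kind) → Kind → ℕ
count N τ K = foldr ℕ._+_ 0 (map (λ x → isKind K (τ x)) (Data.List.allFin N))
  where import Data.List

words : (N L : ℕ) → List (List (Fin N))
words N zero    = [] ∷ []
words N (suc L) = concatMap (λ x → map (x ∷_) (words N L)) (Data.List.allFin N)
  where import Data.List

σ : {N : ℕ} → (Fin N → Kind) → ℕ → List (Fin N) → Bool
σ τ j w = foldl (λ s x → T (τ x) s) false (take j w)

val : Bool → ℚ
val true  = 1ℚ
val false = 0ℚ

_^_ : ℚ → ℕ → ℚ
p ^ zero  = 1ℚ
p ^ suc n = p * (p ^ n)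

sumℚ : List ℚ → ℚ
sumℚ = foldr _+_ 0ℚ

-- Reciprocal of a natural number (only used for nonzero arguments).
inv : ℕ → ℚ
inv zero    = 0ℚ
inv (suc n) = + 1 / suc n

fromℕ : ℕ → ℚ
fromℕ n = + n / 1

-- Division (only used where the denominator is nonzero).
_÷'_ : ℚ → ℚ → ℚ
p ÷' q with q ≟ 0ℚ
... | yes _ = 0ℚ
... | no q≢0 = _÷_ p q {{≢-nonZero q≢0}}

-- Expectation of f(x_1,…,x_L) for x_1,…,x_L i.i.d. uniform on Fin N:
-- (1/N^L) · Σ_{w ∈ X^L} f(w).
E : (N L : ℕ) → (List (Fin N) → ℚ) → ℚ
E N L f = sumℚ (map f (words N L)) * (inv N ^ L)

-- P(σ_j = 1): depends only on x_1..x_j, so computed over X^j.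
Pσ1 : (N : ℕ) → (Fin N → Kind) → ℕ → ℚ
Pσ1 N τ j = E N j (λ w → val (σ τ j w))

ν : {N : ℕ} → (Fin N → Kind) → ℕ → List (Fin N) → ℚ
ν τ L w = sumℚ (map (λ j → val (σ τ j w)) (Data.List.upTo L |> map suc))
  where
    import Data.List
    open import Function using (_|>_)

-- Cov(σ_j, σ_m) for the word x_1..x_L (requires j, m ≤ L).
Cov : (N : ℕ) → (Fin N → Kind) → (L j m : ℕ) → ℚ
Cov N τ L j m =
  E N L (λ w → val (σ τ j w) * val (σ τ m w))
  Data.Rational.- (E N L (λ w → val (σ τ j w)) * E N L (λ w → val (σ τ m w)))
  where import Data.Rational

-- Reading the word letter by letter makes the state a Markov chain on {0,1}: a uniform letter
-- sets the state to 1, keeps it, or sets it to 0, with probabilities g/N, μ = t/N and k/N.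
-- Conditioning on the first letter, the probability of being in state 1 after j letters obeys a
-- linear recurrence; since (π₀, π₁) is stationary (g π₀ = k π₁) and only PROP letters remember
-- the state, its distance from π₁ shrinks by the factor μ per letter, which gives (a).  Summing
-- the resulting geometric progression gives (b).  For (c), σ_j σ_m = 1 exactly when σ_j = 1 and
-- the chain restarted in state 1 is again in state 1 after m − j further letters.

module Submission where

open import Defs
open import Data.Nat using (ℕ; _≤_; _<_)
open import Data.Fin using (Fin)
open import Data.Product using (_×_)
open import Data.Rational using (ℚ; 1ℚ; _+_; _-_; _*_)
open import Relation.Binary.PropositionalEquality using (_≡_)

open import Data.Bool using (Bool; true; false)
open import Data.Empty using (⊥-elim)
import Data.Integer as ℤ
import Data.Integer.Properties as ℤ
import Data.Integer.Tactic.RingSolver as ℤ-Solver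
open import Data.List using (List; []; _∷_; _++_; [_]; map; concatMap; foldl; take; allFin; upTo; length)
import Data.List.Properties as List
open import Data.List.Relation.Unary.All as All using (All)
import Data.List.Relation.Unary.All.Properties as All
open import Data.Nat as ℕ using (zero; suc; z≤n; s≤s; _∸_)
import Data.Nat.ListAction as ℕ
import Data.Nat.Properties as ℕ
open import Data.Product using (_,_)
open import Data.Rational using (0ℚ; toℚᵘ; NonZero; 1/_; ≢-nonZero)
import Data.Rational.Properties as ℚ
open import Data.Rational.Unnormalised as ℚᵘ using (mkℚᵘ; *≡*)
import Data.Rational.Unnormalised.Properties as ℚᵘ
open import Algebra.Bundles using (CommutativeMonoid)
open import Algebra.Properties.CommutativeSemigroup (CommutativeMonoid.commutativeSemigroup ℚ.+-0-commutativeMonoid)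
  using (interchange)
open import Algebra.Properties.CommutativeSemigroup (CommutativeMonoid.commutativeSemigroup ℚ.*-1-commutativeMonoid)
  using (x∙yz≈y∙xz; x∙yz≈yx∙z)
open import Function using (_∘_; id)
open import Level using (0ℓ)
open import Relation.Binary.PropositionalEquality using (refl; sym; trans; cong; cong₂; module ≡-Reasoning)
open import Relation.Nullary using (yes; no)
open import Relation.Nullary.Decidable using (dec⇒maybe)
open import Tactic.RingSolver using (solve-∀)
open import Tactic.RingSolver.Core.AlmostCommutativeRing using (AlmostCommutativeRing; fromCommutativeRing)

ℚ-ring : AlmostCommutativeRing 0ℓ 0ℓ
ℚ-ring = fromCommutativeRing ℚ.+-*-commutativeRing (λ q → dec⇒maybe (0ℚ ℚ.≟ q))

∑ : {A : Set} → List A → (A → ℚ) → ℚ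
∑ xs f = sumℚ (map f xs)

module _ {A : Set} where

  ∑-cong : ∀ {f g : A → ℚ} → (∀ x → f x ≡ g x) → ∀ xs → ∑ xs f ≡ ∑ xs g
  ∑-cong f≗g xs = cong sumℚ (List.map-cong f≗g xs)

  ∑-++ : ∀ xs ys (f : A → ℚ) → ∑ (xs ++ ys) f ≡ ∑ xs f + ∑ ys f
  ∑-++ []       ys f = sym (ℚ.+-identityˡ _)
  ∑-++ (x ∷ xs) ys f = trans (cong (f x +_) (∑-++ xs ys f)) (sym (ℚ.+-assoc (f x) _ _))

  ∑-zero : ∀ (xs : List A) → ∑ xs (λ _ → 0ℚ) ≡ 0ℚ
  ∑-zero []       = refl
  ∑-zero (x ∷ xs) = trans (ℚ.+-identityˡ _) (∑-zero xs)

  ∑-+ : ∀ xs (f g : A → ℚ) → ∑ xs (λ x → f x + g x) ≡ ∑ xs f + ∑ xs g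
  ∑-+ []       f g = refl
  ∑-+ (x ∷ xs) f g = trans (cong (f x + g x +_) (∑-+ xs f g)) (interchange (f x) (g x) _ _)

  ∑-*ˡ : ∀ c xs (f : A → ℚ) → ∑ xs (λ x → c * f x) ≡ c * ∑ xs f
  ∑-*ˡ c []       f = sym (ℚ.*-zeroʳ c)
  ∑-*ˡ c (x ∷ xs) f = trans (cong (c * f x +_) (∑-*ˡ c xs f)) (sym (ℚ.*-distribˡ-+ c (f x) _))

  ∑-*ʳ : ∀ c xs (f : A → ℚ) → ∑ xs (λ x → f x * c) ≡ ∑ xs f * c
  ∑-*ʳ c []       f = sym (ℚ.*-zeroˡ c)
  ∑-*ʳ c (x ∷ xs) f = trans (cong (f x * c +_) (∑-*ʳ c xs f)) (sym (ℚ.*-distribʳ-+ c (f x) _))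

∑-map : ∀ {A B : Set} (g : A → B) xs (f : B → ℚ) → ∑ (map g xs) f ≡ ∑ xs (f ∘ g)
∑-map g xs f = cong sumℚ (sym (List.map-∘ xs))

∑-comm : ∀ {A B : Set} xs ys (F : A → B → ℚ) →
         ∑ xs (λ x → ∑ ys (F x)) ≡ ∑ ys (λ y → ∑ xs (λ x → F x y))
∑-comm []       ys F = sym (∑-zero ys)
∑-comm (x ∷ xs) ys F =
  trans (cong (∑ ys (F x) +_) (∑-comm xs ys F)) (sym (∑-+ ys (F x) (λ y → ∑ xs (λ x → F x y))))

∑-concatMap : ∀ {A B : Set} (g : A → List B) xs (f : B → ℚ) →
              ∑ (concatMap g xs) f ≡ ∑ xs (λ x → ∑ (g x) f)
∑-concatMap g []       f = refl
∑-concatMap g (x ∷ xs) f = trans (∑-++ (g x) (concatMap g xs) f) (cong (∑ (g x) f +_) (∑-concatMap g xs f))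

∑-shifted-upTo-suc : ∀ L (f : ℕ → ℚ) →
                     ∑ (map suc (upTo (suc L))) f ≡ ∑ (map suc (upTo L)) f + f (suc L)
∑-shifted-upTo-suc L f = begin
  ∑ (map suc (upTo (suc L))) f             ≡⟨ cong (λ is → ∑ (map suc is) f) (List.applyUpTo-∷ʳ id L) ⟨
  ∑ (map suc (upTo L ++ [ L ])) f          ≡⟨ cong (λ is → ∑ is f) (List.map-++ suc (upTo L) [ L ]) ⟩
  ∑ (map suc (upTo L) ++ [ suc L ]) f      ≡⟨ ∑-++ (map suc (upTo L)) [ suc L ] f ⟩
  ∑ (map suc (upTo L)) f + (f (suc L) + 0ℚ) ≡⟨ cong (∑ (map suc (upTo L)) f +_) (ℚ.+-identityʳ (f (suc L))) ⟩
  ∑ (map suc (upTo L)) f + f (suc L)       ∎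
  where open ≡-Reasoning

toℚᵘ-fromℕ : ∀ n → toℚᵘ (fromℕ n) ℚᵘ.≃ mkℚᵘ (ℤ.+ n) 0
toℚᵘ-fromℕ n = ℚ.toℚᵘ-fromℚᵘ (mkℚᵘ (ℤ.+ n) 0)

fromℕ-+ : ∀ m n → fromℕ (m ℕ.+ n) ≡ fromℕ m + fromℕ n
fromℕ-+ m n = ℚ.toℚᵘ-injective (begin
  toℚᵘ (fromℕ (m ℕ.+ n))                 ≈⟨ toℚᵘ-fromℕ (m ℕ.+ n) ⟩
  mkℚᵘ (ℤ.+ (m ℕ.+ n)) 0                 ≈⟨ *≡* (trans (cong (ℤ._* ℤ.1ℤ) (ℤ.pos-+ m n)) (numerators (ℤ.+ m) (ℤ.+ n))) ⟩
  mkℚᵘ (ℤ.+ m) 0 ℚᵘ.+ mkℚᵘ (ℤ.+ n) 0     ≈⟨ ℚᵘ.+-cong (toℚᵘ-fromℕ m) (toℚᵘ-fromℕ n) ⟨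
  toℚᵘ (fromℕ m) ℚᵘ.+ toℚᵘ (fromℕ n)     ≈⟨ ℚ.toℚᵘ-homo-+ (fromℕ m) (fromℕ n) ⟨
  toℚᵘ (fromℕ m + fromℕ n)               ∎)
  where
  open ℚᵘ.≃-Reasoning
  numerators : ∀ a b → (a ℤ.+ b) ℤ.* ℤ.1ℤ ≡ (a ℤ.* ℤ.1ℤ ℤ.+ b ℤ.* ℤ.1ℤ) ℤ.* ℤ.1ℤ
  numerators = ℤ-Solver.solve-∀

fromℕ-*-inv : ∀ {n} → 1 ≤ n → fromℕ n * inv n ≡ 1ℚ
fromℕ-*-inv {suc n} _ = ℚ.toℚᵘ-injective (begin
  toℚᵘ (fromℕ (suc n) * inv (suc n))           ≈⟨ ℚ.toℚᵘ-homo-* (fromℕ (suc n)) (inv (suc n)) ⟩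
  toℚᵘ (fromℕ (suc n)) ℚᵘ.* toℚᵘ (inv (suc n)) ≈⟨ ℚᵘ.*-cong (toℚᵘ-fromℕ (suc n)) (ℚ.toℚᵘ-fromℚᵘ (mkℚᵘ ℤ.1ℤ n)) ⟩
  mkℚᵘ (ℤ.+ suc n) 0 ℚᵘ.* mkℚᵘ ℤ.1ℤ n          ≈⟨ *≡* (cross-product (ℤ.+ suc n)) ⟩
  ℚᵘ.1ℚᵘ                                       ∎)
  where
  open ℚᵘ.≃-Reasoning
  cross-product : ∀ a → (a ℤ.* ℤ.1ℤ) ℤ.* ℤ.1ℤ ≡ ℤ.1ℤ ℤ.* (ℤ.1ℤ ℤ.* a)
  cross-product = ℤ-Solver.solve-∀

fromℕ-sum : ∀ {A : Set} (f : A → ℕ) xs → fromℕ (ℕ.sum (map f xs)) ≡ ∑ xs (fromℕ ∘ f)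
fromℕ-sum f []       = refl
fromℕ-sum f (x ∷ xs) = trans (fromℕ-+ (f x) _) (cong (fromℕ (f x) +_) (fromℕ-sum f xs))

∑-one : ∀ {A : Set} (xs : List A) → ∑ xs (λ _ → 1ℚ) ≡ fromℕ (length xs)
∑-one []       = refl
∑-one (x ∷ xs) = trans (cong (1ℚ +_) (∑-one xs)) (sym (fromℕ-+ 1 (length xs)))

^-+ : ∀ x m n → x ^ (m ℕ.+ n) ≡ x ^ m * x ^ n
^-+ x zero    n = sym (ℚ.*-identityˡ (x ^ n))
^-+ x (suc m) n = trans (cong (x *_) (^-+ x m n)) (sym (ℚ.*-assoc x (x ^ m) (x ^ n)))

∑-one-minus-powers : ∀ {μ r} → (1ℚ - μ) * r ≡ 1ℚ → ∀ L →
                     ∑ (map suc (upTo L)) (λ j → 1ℚ - μ ^ j) ≡ fromℕ L - μ * (1ℚ - μ ^ L) * r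
∑-one-minus-powers {μ} {r} _ zero = sym (vanishes μ r)
  where
  vanishes : ∀ μ r → 0ℚ - μ * (1ℚ - 1ℚ) * r ≡ 0ℚ
  vanishes = solve-∀ ℚ-ring
∑-one-minus-powers {μ} {r} inverse (suc L) = begin
  ∑ (map suc (upTo (suc L))) (λ j → 1ℚ - μ ^ j)
    ≡⟨ ∑-shifted-upTo-suc L (λ j → 1ℚ - μ ^ j) ⟩
  ∑ (map suc (upTo L)) (λ j → 1ℚ - μ ^ j) + (1ℚ - μ * X)
    ≡⟨ cong (_+ (1ℚ - μ * X)) (∑-one-minus-powers inverse L) ⟩
  fromℕ L - μ * (1ℚ - X) * r + (1ℚ - μ * X)
    ≡⟨ expand (fromℕ L) μ X r ⟩
  (1ℚ + fromℕ L) - μ * (1ℚ - μ * X) * r + μ * X * ((1ℚ - μ) * r - 1ℚ)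
    ≡⟨ cong (λ e → (1ℚ + fromℕ L) - μ * (1ℚ - μ * X) * r + μ * X * (e - 1ℚ)) inverse ⟩
  (1ℚ + fromℕ L) - μ * (1ℚ - μ * X) * r + μ * X * (1ℚ - 1ℚ)
    ≡⟨ drop-zero (1ℚ + fromℕ L) (μ * (1ℚ - μ * X) * r) (μ * X) ⟩
  (1ℚ + fromℕ L) - μ * (1ℚ - μ * X) * r
    ≡⟨ cong (_- μ * (1ℚ - μ * X) * r) (fromℕ-+ 1 L) ⟨
  fromℕ (suc L) - μ * (1ℚ - μ ^ suc L) * r ∎
  where
  open ≡-Reasoning
  X : ℚ
  X = μ ^ L
  expand : ∀ A μ X r → A - μ * (1ℚ - X) * r + (1ℚ - μ * X)
                     ≡ (1ℚ + A) - μ * (1ℚ - μ * X) * r + μ * X * ((1ℚ - μ) * r - 1ℚ)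
  expand = solve-∀ ℚ-ring
  drop-zero : ∀ A B C → A - B + C * (1ℚ - 1ℚ) ≡ A - B
  drop-zero = solve-∀ ℚ-ring

÷'-by-inverse : ∀ {q r} → q * r ≡ 1ℚ → ∀ x → x ÷' q ≡ x * r
÷'-by-inverse {q} {r} qr≡1 x with q ℚ.≟ 0ℚ
... | yes refl = ⊥-elim (ℚ.1≢0 (trans (sym qr≡1) (ℚ.*-zeroˡ r)))
... | no q≢0   = cong (x *_) (begin
  q⁻¹                ≡⟨ ℚ.*-identityʳ q⁻¹ ⟨
  q⁻¹ * 1ℚ           ≡⟨ cong (q⁻¹ *_) qr≡1 ⟨
  q⁻¹ * (q * r)      ≡⟨ ℚ.*-assoc q⁻¹ q r ⟨
  (q⁻¹ * q) * r      ≡⟨ cong (_* r) (ℚ.*-inverseˡ q) ⟩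
  1ℚ * r             ≡⟨ ℚ.*-identityˡ r ⟩
  r                  ∎)
  where
  open ≡-Reasoning
  instance
    q-nonZero : NonZero q
    q-nonZero = ≢-nonZero q≢0
  q⁻¹ : ℚ
  q⁻¹ = 1/ q

kinds : List Kind
kinds = GEN ∷ PROP ∷ KILL ∷ []

indicator-expansion : ∀ (h : Kind → ℚ) k → h k ≡ ∑ kinds (λ K → fromℕ (isKind K k) * h K)
indicator-expansion h GEN = expand (h GEN) (h PROP) (h KILL)
  where
  expand : ∀ a b c → a ≡ 1ℚ * a + (0ℚ * b + (0ℚ * c + 0ℚ))
  expand = solve-∀ ℚ-ring
indicator-expansion h PROP = expand (h GEN) (h PROP) (h KILL)
  where
  expand : ∀ a b c → b ≡ 0ℚ * a + (1ℚ * b + (0ℚ * c + 0ℚ))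
  expand = solve-∀ ℚ-ring
indicator-expansion h KILL = expand (h GEN) (h PROP) (h KILL)
  where
  expand : ∀ a b c → c ≡ 0ℚ * a + (0ℚ * b + (1ℚ * c + 0ℚ))
  expand = solve-∀ ℚ-ring

∑-byKind : ∀ {A : Set} (τ : A → Kind) (h : Kind → ℚ) xs →
           ∑ xs (h ∘ τ) ≡ ∑ kinds (λ K → fromℕ (ℕ.sum (map (λ x → isKind K (τ x)) xs)) * h K)
∑-byKind τ h xs = begin
  ∑ xs (h ∘ τ)
    ≡⟨ ∑-cong (indicator-expansion h ∘ τ) xs ⟩
  ∑ xs (λ x → ∑ kinds (λ K → fromℕ (isKind K (τ x)) * h K))
    ≡⟨ ∑-comm xs kinds (λ x K → fromℕ (isKind K (τ x)) * h K) ⟩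
  ∑ kinds (λ K → ∑ xs (λ x → fromℕ (isKind K (τ x)) * h K))
    ≡⟨ ∑-cong (λ K → ∑-*ʳ (h K) xs (λ x → fromℕ (isKind K (τ x)))) kinds ⟩
  ∑ kinds (λ K → ∑ xs (λ x → fromℕ (isKind K (τ x))) * h K)
    ≡⟨ ∑-cong (λ K → cong (_* h K) (fromℕ-sum (λ x → isKind K (τ x)) xs)) kinds ⟨
  ∑ kinds (λ K → fromℕ (ℕ.sum (map (λ x → isKind K (τ x)) xs)) * h K) ∎
  where open ≡-Reasoning

-- A letter has kind K with probability w K; reach s j is the probability of being in state 1
-- after j letters when starting in state s.
module TwoStateChain (w : Kind → ℚ) where

  mean : (Kind → ℚ) → ℚ
  mean h = ∑ kinds (λ K → w K * h K)

  reach : Bool → ℕ → ℚ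
  reach s zero    = val s
  reach s (suc j) = mean (λ K → reach (T K s) j)

  mean-*ʳ : ∀ h c → mean (λ K → h K * c) ≡ mean h * c
  mean-*ʳ h c = trans (∑-cong (λ K → sym (ℚ.*-assoc (w K) (h K) c)) kinds) (∑-*ʳ c kinds (λ K → w K * h K))

  mean-const : ∑ kinds w ≡ 1ℚ → ∀ c → mean (λ _ → c) ≡ c
  mean-const w-sum c = trans (∑-*ʳ c kinds w) (trans (cong (_* c) w-sum) (ℚ.*-identityˡ c))

  val-*-reach : ∀ s m → val s * reach s m ≡ val s * reach true m
  val-*-reach true  m = refl
  val-*-reach false m = trans (ℚ.*-zeroˡ (reach false m)) (sym (ℚ.*-zeroˡ (reach true m)))

  -- balance says that (π₀, π₁) is stationary: the chain moves 0 → 1 with probability w GEN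
  -- and 1 → 0 with probability w KILL.
  module Stationary (w-sum : ∑ kinds w ≡ 1ℚ) (π₀ π₁ : ℚ) (π-sum : π₀ + π₁ ≡ 1ℚ)
                    (balance : w GEN * π₀ ≡ w KILL * π₁) where

    μ : ℚ
    μ = w PROP

    balanced : w GEN * π₀ - w KILL * π₁ ≡ 0ℚ
    balanced = trans (cong (_- w KILL * π₁) balance) (ℚ.+-inverseʳ (w KILL * π₁))

    reach-false : ∀ j → reach false j ≡ π₁ * (1ℚ - μ ^ j)
    reach-true  : ∀ j → reach true j ≡ π₁ + π₀ * μ ^ j

    reach-false zero = sym (ℚ.*-zeroʳ π₁)
    reach-false (suc j) = begin
      reach false (suc j)
        ≡⟨⟩
      w GEN * reach true j + (μ * reach false j + (w KILL * reach false j + 0ℚ))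
        ≡⟨ cong₂ (λ t f → w GEN * t + (μ * f + (w KILL * f + 0ℚ))) (reach-true j) (reach-false j) ⟩
      w GEN * (π₁ + π₀ * X) + (μ * (π₁ * (1ℚ - X)) + (w KILL * (π₁ * (1ℚ - X)) + 0ℚ))
        ≡⟨ expand (w GEN) μ (w KILL) π₀ π₁ X ⟩
      π₁ * ∑ kinds w - π₁ * (μ * X) + (w GEN * π₀ - w KILL * π₁) * X
        ≡⟨ cong₂ (λ s d → π₁ * s - π₁ * (μ * X) + d * X) w-sum balanced ⟩
      π₁ * 1ℚ - π₁ * (μ * X) + 0ℚ * X
        ≡⟨ simplify π₁ μ X ⟩
      π₁ * (1ℚ - μ * X) ∎
      where
      open ≡-Reasoning
      X : ℚ
      X = μ ^ j
      expand : ∀ a b c p₀ p₁ X →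
               a * (p₁ + p₀ * X) + (b * (p₁ * (1ℚ - X)) + (c * (p₁ * (1ℚ - X)) + 0ℚ))
               ≡ p₁ * (a + (b + (c + 0ℚ))) - p₁ * (b * X) + (a * p₀ - c * p₁) * X
      expand = solve-∀ ℚ-ring
      simplify : ∀ p₁ b X → p₁ * 1ℚ - p₁ * (b * X) + 0ℚ * X ≡ p₁ * (1ℚ - b * X)
      simplify = solve-∀ ℚ-ring

    reach-true zero = sym (trans (cong (π₁ +_) (ℚ.*-identityʳ π₀)) (trans (ℚ.+-comm π₁ π₀) π-sum))
    reach-true (suc j) = begin
      reach true (suc j)
        ≡⟨⟩
      w GEN * reach true j + (μ * reach true j + (w KILL * reach false j + 0ℚ))
        ≡⟨ cong₂ (λ t f → w GEN * t + (μ * t + (w KILL * f + 0ℚ))) (reach-true j) (reach-false j) ⟩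
      w GEN * (π₁ + π₀ * X) + (μ * (π₁ + π₀ * X) + (w KILL * (π₁ * (1ℚ - X)) + 0ℚ))
        ≡⟨ expand (w GEN) μ (w KILL) π₀ π₁ X ⟩
      π₁ * ∑ kinds w + π₀ * (μ * X) + (w GEN * π₀ - w KILL * π₁) * X
        ≡⟨ cong₂ (λ s d → π₁ * s + π₀ * (μ * X) + d * X) w-sum balanced ⟩
      π₁ * 1ℚ + π₀ * (μ * X) + 0ℚ * X
        ≡⟨ simplify π₀ π₁ (μ * X) X ⟩
      π₁ + π₀ * (μ * X) ∎
      where
      open ≡-Reasoning
      X : ℚ
      X = μ ^ j
      expand : ∀ a b c p₀ p₁ X →
               a * (p₁ + p₀ * X) + (b * (p₁ + p₀ * X) + (c * (p₁ * (1ℚ - X)) + 0ℚ))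
               ≡ p₁ * (a + (b + (c + 0ℚ))) + p₀ * (b * X) + (a * p₀ - c * p₁) * X
      expand = solve-∀ ℚ-ring
      simplify : ∀ p₀ p₁ Y X → p₁ * 1ℚ + p₀ * Y + 0ℚ * X ≡ p₁ + p₀ * Y
      simplify = solve-∀ ℚ-ring

    reach-covariance : ∀ {j m} → j ≤ m →
      reach false j * reach true (m ∸ j) - reach false j * reach false m
        ≡ π₁ * (1ℚ - μ ^ j) * μ ^ (m ∸ j) * (π₀ + π₁ * μ ^ j)
    reach-covariance {j} {m} j≤m = begin
      reach false j * reach true (m ∸ j) - reach false j * reach false m
        ≡⟨ cong₂ _-_ (cong₂ _*_ (reach-false j) (reach-true (m ∸ j))) (cong₂ _*_ (reach-false j) reach-false-m) ⟩
      π₁ * (1ℚ - X) * (π₁ + π₀ * Y) - π₁ * (1ℚ - X) * (π₁ * (1ℚ - X * Y))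
        ≡⟨ factor π₀ π₁ X Y ⟩
      π₁ * (1ℚ - X) * Y * (π₀ + π₁ * X) ∎
      where
      open ≡-Reasoning
      X Y : ℚ
      X = μ ^ j
      Y = μ ^ (m ∸ j)
      reach-false-m : reach false m ≡ π₁ * (1ℚ - X * Y)
      reach-false-m = trans (reach-false m)
        (cong (λ z → π₁ * (1ℚ - z)) (trans (cong (μ ^_) (sym (ℕ.m+[n∸m]≡n j≤m))) (^-+ μ j (m ∸ j))))
      factor : ∀ p₀ p₁ X Y → p₁ * (1ℚ - X) * (p₁ + p₀ * Y) - p₁ * (1ℚ - X) * (p₁ * (1ℚ - X * Y))
                             ≡ p₁ * (1ℚ - X) * Y * (p₀ + p₁ * X)
      factor = solve-∀ ℚ-ring

module Expectation (N : ℕ) where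

  E-suc : ∀ L (f : List (Fin N) → ℚ) →
          E N (suc L) f ≡ inv N * ∑ (allFin N) (λ x → E N L (λ w → f (x ∷ w)))
  E-suc L f = begin
    ∑ (words N (suc L)) f * (inv N * inv N ^ L)
      ≡⟨ cong (_* (inv N * inv N ^ L)) (∑-concatMap (λ x → map (x ∷_) (words N L)) (allFin N) f) ⟩
    ∑ (allFin N) (λ x → ∑ (map (x ∷_) (words N L)) f) * (inv N * inv N ^ L)
      ≡⟨ cong (_* (inv N * inv N ^ L)) (∑-cong (λ x → ∑-map (x ∷_) (words N L) f) (allFin N)) ⟩
    ∑ (allFin N) (λ x → ∑ (words N L) (λ w → f (x ∷ w))) * (inv N * inv N ^ L)
      ≡⟨ x∙yz≈y∙xz (∑ (allFin N) (λ x → ∑ (words N L) (λ w → f (x ∷ w)))) (inv N) (inv N ^ L) ⟩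
    inv N * (∑ (allFin N) (λ x → ∑ (words N L) (λ w → f (x ∷ w))) * inv N ^ L)
      ≡⟨ cong (inv N *_) (∑-*ʳ (inv N ^ L) (allFin N) (λ x → ∑ (words N L) (λ w → f (x ∷ w)))) ⟨
    inv N * ∑ (allFin N) (λ x → E N L (λ w → f (x ∷ w))) ∎
    where open ≡-Reasoning

  E-*ˡ : ∀ L c (f : List (Fin N) → ℚ) → E N L (λ w → c * f w) ≡ c * E N L f
  E-*ˡ L c f = trans (cong (_* inv N ^ L) (∑-*ˡ c (words N L) f)) (ℚ.*-assoc c (∑ (words N L) f) (inv N ^ L))

  E-∑ : ∀ {A : Set} L js (F : A → List (Fin N) → ℚ) →
        E N L (λ w → ∑ js (λ j → F j w)) ≡ ∑ js (λ j → E N L (F j))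
  E-∑ L js F = trans (cong (_* inv N ^ L) (∑-comm (words N L) js (λ w j → F j w)))
                     (sym (∑-*ʳ (inv N ^ L) js (λ j → ∑ (words N L) (F j))))

module UniformWord (N : ℕ) (τ : Fin N → Kind) where

  weight : Kind → ℚ
  weight K = fromℕ (count N τ K) * inv N

  open TwoStateChain weight public
  open Expectation N

  run : Bool → ℕ → List (Fin N) → Bool
  run s j w = foldl (λ s x → T (τ x) s) s (take j w)

  average-byKind : ∀ h → inv N * ∑ (allFin N) (h ∘ τ) ≡ mean h
  average-byKind h = begin
    inv N * ∑ (allFin N) (h ∘ τ)                         ≡⟨ cong (inv N *_) (∑-byKind τ h (allFin N)) ⟩
    inv N * ∑ kinds (λ K → fromℕ (count N τ K) * h K)    ≡⟨ ∑-*ˡ (inv N) kinds (λ K → fromℕ (count N τ K) * h K) ⟨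
    ∑ kinds (λ K → inv N * (fromℕ (count N τ K) * h K))  ≡⟨ ∑-cong (λ K → x∙yz≈yx∙z (inv N) (fromℕ (count N τ K)) (h K)) kinds ⟩
    mean h                                               ∎
    where open ≡-Reasoning

  module _ (N≥1 : 1 ≤ N) where

    weight-sum : ∑ kinds weight ≡ 1ℚ
    weight-sum = begin
      ∑ kinds weight                    ≡⟨ ∑-cong (λ K → ℚ.*-identityʳ (weight K)) kinds ⟨
      mean (λ _ → 1ℚ)                   ≡⟨ average-byKind (λ _ → 1ℚ) ⟨
      inv N * ∑ (allFin N) (λ _ → 1ℚ)   ≡⟨ cong (inv N *_) (∑-one (allFin N)) ⟩
      inv N * fromℕ (length (allFin N)) ≡⟨ cong (λ n → inv N * fromℕ n) (List.length-tabulate {n = N} id) ⟩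
      inv N * fromℕ N                   ≡⟨ ℚ.*-comm (inv N) (fromℕ N) ⟩
      fromℕ N * inv N                   ≡⟨ fromℕ-*-inv N≥1 ⟩
      1ℚ                                ∎
      where open ≡-Reasoning

    E-const : ∀ L c → E N L (λ _ → c) ≡ c
    E-const zero    c = trans (ℚ.*-identityʳ (c + 0ℚ)) (ℚ.+-identityʳ c)
    E-const (suc L) c = begin
      E N (suc L) (λ _ → c)                              ≡⟨ E-suc L (λ _ → c) ⟩
      inv N * ∑ (allFin N) (λ _ → E N L (λ _ → c))       ≡⟨ cong (inv N *_) (∑-cong (λ _ → E-const L c) (allFin N)) ⟩
      inv N * ∑ (allFin N) (λ _ → c)                     ≡⟨ average-byKind (λ _ → c) ⟩
      mean (λ _ → c)                                     ≡⟨ mean-const weight-sum c ⟩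
      c                                                  ∎
      where open ≡-Reasoning

    E-run : ∀ L j s → j ≤ L → E N L (λ w → val (run s j w)) ≡ reach s j
    E-run L       zero    s _         = E-const L (val s)
    E-run (suc L) (suc j) s (s≤s j≤L) = begin
      E N (suc L) (λ w → val (run s (suc j) w))
        ≡⟨ E-suc L (λ w → val (run s (suc j) w)) ⟩
      inv N * ∑ (allFin N) (λ x → E N L (λ w → val (run (T (τ x) s) j w)))
        ≡⟨ cong (inv N *_) (∑-cong (λ x → E-run L j (T (τ x) s) j≤L) (allFin N)) ⟩
      inv N * ∑ (allFin N) (λ x → reach (T (τ x) s) j)
        ≡⟨ average-byKind (λ K → reach (T K s) j) ⟩
      reach s (suc j) ∎
      where open ≡-Reasoning

    E-run-product : ∀ L j m s → j ≤ m → m ≤ L →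
      E N L (λ w → val (run s j w) * val (run s m w)) ≡ reach s j * reach true (m ∸ j)
    E-run-product L zero m s _ m≤L = begin
      E N L (λ w → val s * val (run s m w)) ≡⟨ E-*ˡ L (val s) (λ w → val (run s m w)) ⟩
      val s * E N L (λ w → val (run s m w)) ≡⟨ cong (val s *_) (E-run L m s m≤L) ⟩
      val s * reach s m                     ≡⟨ val-*-reach s m ⟩
      val s * reach true m                  ∎
      where open ≡-Reasoning
    E-run-product (suc L) (suc j) (suc m) s (s≤s j≤m) (s≤s m≤L) = begin
      E N (suc L) (λ w → val (run s (suc j) w) * val (run s (suc m) w))
        ≡⟨ E-suc L (λ w → val (run s (suc j) w) * val (run s (suc m) w)) ⟩
      inv N * ∑ (allFin N) (λ x → E N L (λ w → val (run (T (τ x) s) j w) * val (run (T (τ x) s) m w)))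
        ≡⟨ cong (inv N *_) (∑-cong (λ x → E-run-product L j m (T (τ x) s) j≤m m≤L) (allFin N)) ⟩
      inv N * ∑ (allFin N) (λ x → reach (T (τ x) s) j * reach true (m ∸ j))
        ≡⟨ average-byKind (λ K → reach (T K s) j * reach true (m ∸ j)) ⟩
      mean (λ K → reach (T K s) j * reach true (m ∸ j))
        ≡⟨ mean-*ʳ (λ K → reach (T K s) j) (reach true (m ∸ j)) ⟩
      reach s (suc j) * reach true (m ∸ j) ∎
      where open ≡-Reasoning

    E-ν≡∑-reach : ∀ L → E N L (ν τ L) ≡ ∑ (map suc (upTo L)) (reach false)
    E-ν≡∑-reach L = trans (E-∑ L (map suc (upTo L)) (λ j w → val (run false j w)))
                          (cong sumℚ (List.map-cong-local E-run-on-range))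
      where
      E-run-on-range : All (λ j → E N L (λ w → val (run false j w)) ≡ reach false j) (map suc (upTo L))
      E-run-on-range = All.map⁺ (All.map (λ {i} i<L → E-run L (suc i) false i<L) (All.all-upTo L))

    Cov≡reach : ∀ L j m → j ≤ m → m ≤ L →
      Cov N τ L j m ≡ reach false j * reach true (m ∸ j) - reach false j * reach false m
    Cov≡reach L j m j≤m m≤L =
      cong₂ _-_ (E-run-product L j m false j≤m m≤L)
                (cong₂ _*_ (E-run L j false (ℕ.≤-trans j≤m m≤L)) (E-run L m false m≤L))

    module Proportions (g+k≥1 : 1 ≤ count N τ GEN ℕ.+ count N τ KILL) where

      g k : ℕ
      g = count N τ GEN
      k = count N τ KILL

      π₀ π₁ : ℚ
      π₀ = fromℕ k * inv (g ℕ.+ k)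
      π₁ = fromℕ g * inv (g ℕ.+ k)

      g+k-*-inv : (fromℕ g + fromℕ k) * inv (g ℕ.+ k) ≡ 1ℚ
      g+k-*-inv = trans (cong (_* inv (g ℕ.+ k)) (sym (fromℕ-+ g k))) (fromℕ-*-inv g+k≥1)

      π-sum : π₀ + π₁ ≡ 1ℚ
      π-sum = trans (collect (fromℕ g) (fromℕ k) (inv (g ℕ.+ k))) g+k-*-inv
        where
        collect : ∀ G K p → K * p + G * p ≡ (G + K) * p
        collect = solve-∀ ℚ-ring

      balance : weight GEN * π₀ ≡ weight KILL * π₁
      balance = exchange (fromℕ g) (fromℕ k) (inv N) (inv (g ℕ.+ k))
        where
        exchange : ∀ G K n p → G * n * (K * p) ≡ K * n * (G * p)
        exchange = solve-∀ ℚ-ring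

      open Stationary weight-sum π₀ π₁ π-sum balance

      -- 1 − μ = (g + k)/N, so the ÷' in (b) is not at its junk value for 0.
      one-minus-μ-inverse : (1ℚ - μ) * (fromℕ N * inv (g ℕ.+ k)) ≡ 1ℚ
      one-minus-μ-inverse = begin
        (1ℚ - μ) * (fromℕ N * inv (g ℕ.+ k))
          ≡⟨ cong (λ s → (s - μ) * (fromℕ N * inv (g ℕ.+ k))) weight-sum ⟨
        (∑ kinds weight - μ) * (fromℕ N * inv (g ℕ.+ k))
          ≡⟨ regroup (fromℕ g) (fromℕ (count N τ PROP)) (fromℕ k) (inv N) (inv (g ℕ.+ k)) (fromℕ N) ⟩
        (fromℕ g + fromℕ k) * inv (g ℕ.+ k) * (fromℕ N * inv N)
          ≡⟨ cong₂ _*_ g+k-*-inv (fromℕ-*-inv N≥1) ⟩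
        1ℚ * 1ℚ
          ≡⟨ ℚ.*-identityˡ 1ℚ ⟩
        1ℚ ∎
        where
        open ≡-Reasoning
        regroup : ∀ G T K n p M → (G * n + (T * n + (K * n + 0ℚ)) - T * n) * (M * p) ≡ (G + K) * p * (M * n)
        regroup = solve-∀ ℚ-ring

      Pσ1-closed-form : ∀ j → Pσ1 N τ j ≡ π₁ * (1ℚ - μ ^ j)
      Pσ1-closed-form j = trans (E-run j j false ℕ.≤-refl) (reach-false j)

      Eν-closed-form : ∀ L → E N L (ν τ L) ≡ π₁ * (fromℕ L - (μ * (1ℚ - μ ^ L)) ÷' (1ℚ - μ))
      Eν-closed-form L = begin
        E N L (ν τ L)
          ≡⟨ E-ν≡∑-reach L ⟩
        ∑ (map suc (upTo L)) (reach false)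
          ≡⟨ ∑-cong reach-false (map suc (upTo L)) ⟩
        ∑ (map suc (upTo L)) (λ j → π₁ * (1ℚ - μ ^ j))
          ≡⟨ ∑-*ˡ π₁ (map suc (upTo L)) (λ j → 1ℚ - μ ^ j) ⟩
        π₁ * ∑ (map suc (upTo L)) (λ j → 1ℚ - μ ^ j)
          ≡⟨ cong (π₁ *_) (∑-one-minus-powers {μ} one-minus-μ-inverse L) ⟩
        π₁ * (fromℕ L - μ * (1ℚ - μ ^ L) * (fromℕ N * inv (g ℕ.+ k)))
          ≡⟨ cong (λ d → π₁ * (fromℕ L - d)) (÷'-by-inverse {1ℚ - μ} one-minus-μ-inverse (μ * (1ℚ - μ ^ L))) ⟨
        π₁ * (fromℕ L - (μ * (1ℚ - μ ^ L)) ÷' (1ℚ - μ)) ∎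
        where open ≡-Reasoning

      Cov-closed-form : ∀ L j m → j ≤ m → m ≤ L →
                        Cov N τ L j m ≡ π₁ * (1ℚ - μ ^ j) * μ ^ (m ∸ j) * (π₀ + π₁ * μ ^ j)
      Cov-closed-form L j m j≤m m≤L = trans (Cov≡reach L j m j≤m m≤L) (reach-covariance j≤m)

proposition6p6 : (N : ℕ) (τ : Fin N → Kind) →
    let g = count N τ GEN
        t = count N τ PROP
        k = count N τ KILL
        μ = fromℕ t * inv N
        π₀ = fromℕ k * inv (g Data.Nat.+ k)
        π₁ = fromℕ g * inv (g Data.Nat.+ k)
    in 1 ≤ g Data.Nat.+ k →
       ((j : ℕ) → 1 ≤ j → Pσ1 N τ j ≡ π₁ * (1ℚ - μ ^ j))
     × ((L : ℕ) → E N L (ν τ L) ≡ π₁ * (fromℕ L - (μ * (1ℚ - μ ^ L)) ÷' (1ℚ - μ)))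
     × ((L j m : ℕ) → 1 ≤ j → j < m → m ≤ L →
          Cov N τ L j m ≡ π₁ * (1ℚ - μ ^ j) * (μ ^ (m Data.Nat.∸ j)) * (π₀ + π₁ * μ ^ j))
-- (a) and (c) hold for j = 0 as well.
proposition6p6 zero    τ ()
proposition6p6 (suc n) τ g+k≥1 =
    (λ j _ → Pσ1-closed-form j)
  , Eν-closed-form
  , (λ L j m _ j<m m≤L → Cov-closed-form L j m (ℕ.<⇒≤ j<m) m≤L)
  where
  open UniformWord (suc n) τ
  open Proportions (s≤s z≤n) g+k≥1
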